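{- Let $n \ge 2$, $V=\{1,\dots,n\}$, and let $\tau : V \to \{1,\dots,n\}$ be a bijection. Let $G_n=(V,E)$ be the graph obtained as follows: the vertices are inserted one at a time in increasing order of $\tau$ (vertex $x$ is inserted at time $\tau(x)$); when $x$ is inserted, it is joined by an undirected edge to the largest $y<x$ with $\tau(y)<\tau(x)$ (if such $y$ exists) and to the smallest $y>x$ with $\tau(y)<\tau(x)$ (if such $y$ exists). Then for $1 \le x < y \le n$, the edge $\{x,y\}$ belongs to $E$ if and only if \[ \max\{\tau(x),\tau(y)\} < \min_{z \in \{x+1,\dots,y-1\}} \tau(z) \] (with the minimum over the empty set equal to $+\infty$). Equivalently, $x$ and $y$ are the two vertices with the smallest values of $\tau$ in the interval $\{x,x+1,\dots,y\}$.
   Context: In the paper $\tau$ is a uniformly random permutation (the insertion-time function), but the statement holds for each fixed bijection $\tau$. -}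

module Defs where

open import Data.Nat using (ℕ)
open import Data.Fin using (Fin; _<_)
open import Data.Sum using (_⊎_)
open import Relation.Nullary using (¬_)
open import Data.Product using (_×_; ∃-syntax)

-- Vertices V = {1..n} are modelled as Fin n (0-based, order-preserving shift).
-- τ : Fin n → Fin n is the insertion time (assumed bijective in the statement).

LeftNbr : ∀ {n} → (Fin n → Fin n) → Fin n → Fin n → Set
LeftNbr τ x y = (y < x) × (τ y < τ x) ×
  (∀ z → y < z → z < x → ¬ (τ z < τ x))

RightNbr : ∀ {n} → (Fin n → Fin n) → Fin n → Fin n → Set
RightNbr τ x y = (x < y) × (τ y < τ x) ×
  (∀ z → x < z → z < y → ¬ (τ z < τ x))

Edge : ∀ {n} → (Fin n → Fin n) → Fin n → Fin n → Set
Edge τ x y = (LeftNbr τ x y ⊎ RightNbr τ x y) ⊎ (LeftNbr τ y x ⊎ RightNbr τ y x)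

{-# OPTIONS --safe #-}
-- If x < y are joined, the endpoint inserted later found the other one as its
-- nearest earlier-inserted vertex on that side, so every vertex strictly between
-- them is inserted after both. Conversely, if the whole interior comes after both
-- endpoints, the nearest earlier-inserted vertex of the later endpoint, on the side
-- of the earlier one, is that earlier endpoint.
module Submission where

open import Defs
open import Data.Nat using (ℕ; _≥_)
import Data.Nat.Properties as ℕ
open import Data.Fin using (Fin; _<_)
open import Data.Fin.Properties using (<-asym; <-trans; <-cmp; <⇒≢; ≤∧≢⇒<)
open import Data.Product using (_×_; _,_; proj₁; proj₂)
open import Data.Sum using (inj₁; inj₂)
open import Function.Base using (_∘_)
open import Function.Definitions using (Injective; Bijective)
open import Function.Bundles using (_⇔_; mk⇔)
open import Relation.Binary.Definitions using (tri<; tri≈; tri>)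
open import Relation.Binary.PropositionalEquality using (_≡_; _≢_; sym)
open import Relation.Nullary using (¬_; contradiction)

≯∧≢⇒< : ∀ {n} {i j : Fin n} → ¬ (j < i) → i ≢ j → i < j
≯∧≢⇒< j≮i = ≤∧≢⇒< (ℕ.≮⇒≥ j≮i)

InsertedBeforeInterior : ∀ {n} → (Fin n → Fin n) → Fin n → Fin n → Set
InsertedBeforeInterior τ x y = ∀ z → x < z → z < y → (τ x < τ z) × (τ y < τ z)

module _ {n : ℕ} (τ : Fin n → Fin n) {x y : Fin n} where

  rightNbr⇒insertedBeforeInterior : Injective _≡_ _≡_ τ →
    RightNbr τ x y → InsertedBeforeInterior τ x y
  rightNbr⇒insertedBeforeInterior τ-injective (_ , τy<τx , gap) z x<z z<y =
    τx<τz , <-trans τy<τx τx<τz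
    where
    τx<τz : τ x < τ z
    τx<τz = ≯∧≢⇒< (gap z x<z z<y) (<⇒≢ x<z ∘ τ-injective)

  leftNbr⇒insertedBeforeInterior : Injective _≡_ _≡_ τ →
    LeftNbr τ y x → InsertedBeforeInterior τ x y
  leftNbr⇒insertedBeforeInterior τ-injective (_ , τx<τy , gap) z x<z z<y =
    <-trans τx<τy τy<τz , τy<τz
    where
    τy<τz : τ y < τ z
    τy<τz = ≯∧≢⇒< (gap z x<z z<y) (<⇒≢ z<y ∘ sym ∘ τ-injective)

  insertedBeforeInterior⇒rightNbr : x < y → τ y < τ x →
    InsertedBeforeInterior τ x y → RightNbr τ x y
  insertedBeforeInterior⇒rightNbr x<y τy<τx later =
    x<y , τy<τx , λ z x<z z<y → <-asym (proj₁ (later z x<z z<y))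

  insertedBeforeInterior⇒leftNbr : x < y → τ x < τ y →
    InsertedBeforeInterior τ x y → LeftNbr τ y x
  insertedBeforeInterior⇒leftNbr x<y τx<τy later =
    x<y , τx<τy , λ z x<z z<y → <-asym (proj₂ (later z x<z z<y))

lemma3p1 : (n : ℕ) → n ≥ 2 → (τ : Fin n → Fin n) → Bijective _≡_ _≡_ τ →
    (x y : Fin n) → x < y →
    Edge τ x y ⇔ (∀ z → x < z → z < y → (τ x < τ z) × (τ y < τ z))
lemma3p1 _ _ τ (τ-injective , _) x y x<y = mk⇔ edge⇒later later⇒edge
  where
  edge⇒later : Edge τ x y → InsertedBeforeInterior τ x y
  edge⇒later (inj₁ (inj₁ (y<x , _))) = contradiction y<x (<-asym x<y)
  edge⇒later (inj₁ (inj₂ nbr))       = rightNbr⇒insertedBeforeInterior τ τ-injective nbr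
  edge⇒later (inj₂ (inj₁ nbr))       = leftNbr⇒insertedBeforeInterior τ τ-injective nbr
  edge⇒later (inj₂ (inj₂ (y<x , _))) = contradiction y<x (<-asym x<y)

  later⇒edge : InsertedBeforeInterior τ x y → Edge τ x y
  later⇒edge later with <-cmp (τ x) (τ y)
  ... | tri< τx<τy _ _ = inj₂ (inj₁ (insertedBeforeInterior⇒leftNbr τ x<y τx<τy later))
  ... | tri≈ _ τx≡τy _ = contradiction (τ-injective τx≡τy) (<⇒≢ x<y)
  ... | tri> _ _ τy<τx = inj₁ (inj₂ (insertedBeforeInterior⇒rightNbr τ x<y τy<τx later))
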